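{- For an arbitrary integer $t$, define \[ \begin{aligned} x_1&=2t(1358127t^{16}+2536920t^{14}-1378620t^{12}-2647512t^{10}-1562886t^{8}-523416t^{6}-108028t^{4}-9192t^{2}-369),\\ x_2&=2t(1003833t^{16}+2256984t^{14}+2211948t^{12}+3067848t^{10}+1484550t^{8}+503592t^{6}+85964t^{4}+6456t^{2}+9),\\ x_3&=2t(59049t^{16}+4706424t^{14}+6963084t^{12}+4532328t^{10}+1484550t^{8}+340872t^{6}+27308t^{4}+3096t^{2}+153),\\ x_4&=2t(2421009t^{16}+6700968t^{14}+8750268t^{12}+4710744t^{10}+1562886t^{8}+294168t^{6}+17020t^{4}-3480t^{2}-207),\\ x_5&=(3t^2-1)(27t^4-2t^2+3)(19683t^{12}+16362t^{10}+34533t^{8}+8748t^{6}+3837t^{4}+202t^{2}+27). \end{aligned} \] Then for each $j\in\{1,\dots,5\}$, the sum $\sum_{i\neq j}x_i^2$ of the other four squares is a perfect square. -}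

module Defs where

open import Data.Nat using (ℕ)
open import Data.Integer using (ℤ; +_; _+_; _-_; _*_; _^_)
open import Data.Fin using (Fin; zero; suc)
open import Data.Fin.Patterns using (0F; 1F; 2F; 3F; 4F)

x₁ x₂ x₃ x₄ x₅ : ℤ → ℤ
x₁ t = + 2 * t * (+ 1358127 * t ^ 16 + + 2536920 * t ^ 14 - + 1378620 * t ^ 12
         - + 2647512 * t ^ 10 - + 1562886 * t ^ 8 - + 523416 * t ^ 6
         - + 108028 * t ^ 4 - + 9192 * t ^ 2 - + 369)
x₂ t = + 2 * t * (+ 1003833 * t ^ 16 + + 2256984 * t ^ 14 + + 2211948 * t ^ 12
         + + 3067848 * t ^ 10 + + 1484550 * t ^ 8 + + 503592 * t ^ 6
         + + 85964 * t ^ 4 + + 6456 * t ^ 2 + + 9)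
x₃ t = + 2 * t * (+ 59049 * t ^ 16 + + 4706424 * t ^ 14 + + 6963084 * t ^ 12
         + + 4532328 * t ^ 10 + + 1484550 * t ^ 8 + + 340872 * t ^ 6
         + + 27308 * t ^ 4 + + 3096 * t ^ 2 + + 153)
x₄ t = + 2 * t * (+ 2421009 * t ^ 16 + + 6700968 * t ^ 14 + + 8750268 * t ^ 12
         + + 4710744 * t ^ 10 + + 1562886 * t ^ 8 + + 294168 * t ^ 6
         + + 17020 * t ^ 4 - + 3480 * t ^ 2 - + 207)
x₅ t = (+ 3 * t ^ 2 - + 1) * (+ 27 * t ^ 4 - + 2 * t ^ 2 + + 3)
       * (+ 19683 * t ^ 12 + + 16362 * t ^ 10 + + 34533 * t ^ 8 + + 8748 * t ^ 6
          + + 3837 * t ^ 4 + + 202 * t ^ 2 + + 27)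

x : ℤ → Fin 5 → ℤ
x t zero = x₁ t
x t (suc zero) = x₂ t
x t (suc (suc zero)) = x₃ t
x t (suc (suc (suc zero))) = x₄ t
x t (suc (suc (suc (suc zero)))) = x₅ t

sq : ℤ → ℤ
sq a = a * a

sumOthersSq : ℤ → Fin 5 → ℤ
sumOthersSq t zero = sq (x t 1F) + sq (x t 2F) + sq (x t 3F) + sq (x t 4F)
sumOthersSq t (suc zero) = sq (x t 0F) + sq (x t 2F) + sq (x t 3F) + sq (x t 4F)
sumOthersSq t (suc (suc zero)) = sq (x t 0F) + sq (x t 1F) + sq (x t 3F) + sq (x t 4F)
sumOthersSq t (suc (suc (suc zero))) = sq (x t 0F) + sq (x t 1F) + sq (x t 2F) + sq (x t 4F)
sumOthersSq t (suc (suc (suc (suc zero)))) = sq (x t 0F) + sq (x t 1F) + sq (x t 2F) + sq (x t 3F)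

-- Each of the five claims is an identity in ℤ[t]: the sum of the four
-- other squares equals y_j(t)², for an explicit polynomial y_j of degree 18.
-- Such identities are decided by computation: both sides are normalised to
-- coefficient lists, which evaluation maps homomorphically back into any
-- commutative ring, so equal lists give equal values at every t.
module Submission where

open import Algebra.Bundles using (CommutativeRing)
open import Data.List.Base using (List; []; _∷_; map)
open import Data.Nat.Base using (ℕ; zero; suc)

module UnivariatePolynomial {c ℓ} (R : CommutativeRing c ℓ) where

  open CommutativeRing R
  open import Algebra.Properties.Ring ring using (-0#≈0#; -‿distribʳ-*; -‿+-comm)
  open import Relation.Binary.Reasoning.Setoid setoid
  open import Algebra.Properties.CommutativeSemigroup +-commutativeSemigroup
    using () renaming (interchange to +-interchange)
  open import Algebra.Properties.CommutativeSemigroup *-commutativeSemigroup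
    using () renaming (x∙yz≈y∙xz to x*yz≈y*xz)

  -- Dense representation, constant coefficient first.
  Poly : Set c
  Poly = List Carrier

  eval : Poly → Carrier → Carrier
  eval []      t = 0#
  eval (a ∷ p) t = a + t * eval p t

  infixl 6 _⊞_
  infixl 7 _⊠_

  _⊞_ : Poly → Poly → Poly
  []      ⊞ q       = q
  (a ∷ p) ⊞ []      = a ∷ p
  (a ∷ p) ⊞ (b ∷ q) = a + b ∷ p ⊞ q

  ⊟_ : Poly → Poly
  ⊟_ = map (-_)

  scale : Carrier → Poly → Poly
  scale a = map (a *_)

  _⊠_ : Poly → Poly → Poly
  []      ⊠ q = []
  (a ∷ p) ⊠ q = scale a q ⊞ (0# ∷ p ⊠ q)

  monomial : ℕ → Poly
  monomial zero    = 1# ∷ []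
  monomial (suc n) = 0# ∷ monomial n

  eval-constant : ∀ a t → eval (a ∷ []) t ≈ a
  eval-constant a t = trans (+-congˡ (zeroʳ t)) (+-identityʳ a)

  eval-⊞ : ∀ p q t → eval (p ⊞ q) t ≈ eval p t + eval q t
  eval-⊞ []      q       t = sym (+-identityˡ _)
  eval-⊞ (a ∷ p) []      t = sym (+-identityʳ _)
  eval-⊞ (a ∷ p) (b ∷ q) t = begin
    a + b + t * eval (p ⊞ q) t                ≈⟨ +-congˡ (*-congˡ (eval-⊞ p q t)) ⟩
    a + b + t * (eval p t + eval q t)         ≈⟨ +-congˡ (distribˡ t (eval p t) (eval q t)) ⟩
    a + b + (t * eval p t + t * eval q t)     ≈⟨ +-interchange a b (t * eval p t) (t * eval q t) ⟩
    a + t * eval p t + (b + t * eval q t)     ∎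

  eval-⊟ : ∀ p t → eval (⊟ p) t ≈ - eval p t
  eval-⊟ []      t = sym -0#≈0#
  eval-⊟ (a ∷ p) t = begin
    - a + t * eval (⊟ p) t  ≈⟨ +-congˡ (*-congˡ (eval-⊟ p t)) ⟩
    - a + t * - eval p t    ≈⟨ +-congˡ (-‿distribʳ-* t (eval p t)) ⟨
    - a + - (t * eval p t)  ≈⟨ -‿+-comm a (t * eval p t) ⟩
    - (a + t * eval p t)    ∎

  eval-scale : ∀ a q t → eval (scale a q) t ≈ a * eval q t
  eval-scale a []      t = sym (zeroʳ a)
  eval-scale a (b ∷ q) t = begin
    a * b + t * eval (scale a q) t  ≈⟨ +-congˡ (*-congˡ (eval-scale a q t)) ⟩
    a * b + t * (a * eval q t)      ≈⟨ +-congˡ (x*yz≈y*xz t a (eval q t)) ⟩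
    a * b + a * (t * eval q t)      ≈⟨ distribˡ a b (t * eval q t) ⟨
    a * (b + t * eval q t)          ∎

  eval-⊠ : ∀ p q t → eval (p ⊠ q) t ≈ eval p t * eval q t
  eval-⊠ []      q t = sym (zeroˡ _)
  eval-⊠ (a ∷ p) q t = begin
    eval (scale a q ⊞ (0# ∷ p ⊠ q)) t             ≈⟨ eval-⊞ (scale a q) (0# ∷ p ⊠ q) t ⟩
    eval (scale a q) t + (0# + t * eval (p ⊠ q) t) ≈⟨ +-cong (eval-scale a q t) shifted ⟩
    a * eval q t + t * (eval p t * eval q t)      ≈⟨ +-congˡ (*-assoc t (eval p t) (eval q t)) ⟨
    a * eval q t + t * eval p t * eval q t        ≈⟨ distribʳ (eval q t) a (t * eval p t) ⟨
    (a + t * eval p t) * eval q t                 ∎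
    where
    shifted : 0# + t * eval (p ⊠ q) t ≈ t * (eval p t * eval q t)
    shifted = trans (+-identityˡ _) (*-congˡ (eval-⊠ p q t))

open import Data.Fin.Base using (Fin)
open import Data.Fin.Patterns using (0F; 1F; 2F; 3F; 4F)
open import Data.Integer.Base using (ℤ; +_; -_; _+_; _-_; _*_; _^_; 1ℤ)
open import Data.Integer.Properties
  using (+-*-commutativeRing; +-identityˡ; *-identityʳ)
open import Data.Product.Base using (∃; _,_)
open import Relation.Binary.PropositionalEquality as ≡ using (_≡_; trans; cong; cong₂)
open ≡.≡-Reasoning

open import Defs

open UnivariatePolynomial +-*-commutativeRing
  using (Poly; eval; _⊞_; ⊟_; _⊠_; monomial; eval-constant; eval-⊞; eval-⊟; eval-⊠)

-- ⟦_⟧ uses exactly the integer operations of Defs, so ⟦ xExpr j ⟧ t is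
-- definitionally x t j.  Only the variable is raised to powers: _⊠_ uses its
-- right factor once per coefficient of the left one, and reduction during type
-- checking does not share it, so a general power would normalise in time
-- exponential in the exponent.
infixl 6 _:+_ _:-_
infixl 7 _:*_

data Expr : Set where
  con            : ℤ → Expr
  var            : Expr
  var^_          : ℕ → Expr
  _:+_ _:-_ _:*_ : Expr → Expr → Expr

⟦_⟧ : Expr → ℤ → ℤ
⟦ con a  ⟧ t = a
⟦ var    ⟧ t = t
⟦ var^ n ⟧ t = t ^ n
⟦ e :+ f ⟧ t = ⟦ e ⟧ t + ⟦ f ⟧ t
⟦ e :- f ⟧ t = ⟦ e ⟧ t - ⟦ f ⟧ t
⟦ e :* f ⟧ t = ⟦ e ⟧ t * ⟦ f ⟧ t

-- Trailing zero coefficients are not removed, so equal normal forms are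
-- sufficient but not necessary for equal polynomials.
norm : Expr → Poly
norm (con a)  = a ∷ []
norm var      = monomial 1
norm (var^ n) = monomial n
norm (e :+ f) = norm e ⊞ norm f
norm (e :- f) = norm e ⊞ ⊟ norm f
norm (e :* f) = norm e ⊠ norm f

eval-monomial : ∀ n t → eval (monomial n) t ≡ t ^ n
eval-monomial zero    t = eval-constant 1ℤ t
eval-monomial (suc n) t = trans (+-identityˡ _) (cong (t *_) (eval-monomial n t))

eval-norm : ∀ e t → eval (norm e) t ≡ ⟦ e ⟧ t
eval-norm (con a)  t = eval-constant a t
eval-norm var      t = trans (eval-monomial 1 t) (*-identityʳ t)
eval-norm (var^ n) t = eval-monomial n t
eval-norm (e :+ f) t = trans (eval-⊞ (norm e) (norm f) t) (cong₂ _+_ (eval-norm e t) (eval-norm f t))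
eval-norm (e :- f) t = trans (eval-⊞ (norm e) (⊟ norm f) t)
                             (cong₂ _+_ (eval-norm e t) (trans (eval-⊟ (norm f) t) (cong -_ (eval-norm f t))))
eval-norm (e :* f) t = trans (eval-⊠ (norm e) (norm f) t) (cong₂ _*_ (eval-norm e t) (eval-norm f t))

norm≡⇒⟦⟧≡ : ∀ e f → norm e ≡ norm f → ∀ t → ⟦ e ⟧ t ≡ ⟦ f ⟧ t
norm≡⇒⟦⟧≡ e f norm-e≡norm-f t = begin
  ⟦ e ⟧ t          ≡⟨ eval-norm e t ⟨
  eval (norm e) t  ≡⟨ cong (λ p → eval p t) norm-e≡norm-f ⟩
  eval (norm f) t  ≡⟨ eval-norm f t ⟩
  ⟦ f ⟧ t          ∎

xExpr : Fin 5 → Expr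
xExpr 0F = con (+ 2) :* var :* (con (+ 1358127) :* var^ 16 :+ con (+ 2536920) :* var^ 14
         :- con (+ 1378620) :* var^ 12 :- con (+ 2647512) :* var^ 10 :- con (+ 1562886) :* var^ 8
         :- con (+ 523416) :* var^ 6 :- con (+ 108028) :* var^ 4 :- con (+ 9192) :* var^ 2 :- con (+ 369))
xExpr 1F = con (+ 2) :* var :* (con (+ 1003833) :* var^ 16 :+ con (+ 2256984) :* var^ 14
         :+ con (+ 2211948) :* var^ 12 :+ con (+ 3067848) :* var^ 10 :+ con (+ 1484550) :* var^ 8
         :+ con (+ 503592) :* var^ 6 :+ con (+ 85964) :* var^ 4 :+ con (+ 6456) :* var^ 2 :+ con (+ 9))
xExpr 2F = con (+ 2) :* var :* (con (+ 59049) :* var^ 16 :+ con (+ 4706424) :* var^ 14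
         :+ con (+ 6963084) :* var^ 12 :+ con (+ 4532328) :* var^ 10 :+ con (+ 1484550) :* var^ 8
         :+ con (+ 340872) :* var^ 6 :+ con (+ 27308) :* var^ 4 :+ con (+ 3096) :* var^ 2 :+ con (+ 153))
xExpr 3F = con (+ 2) :* var :* (con (+ 2421009) :* var^ 16 :+ con (+ 6700968) :* var^ 14
         :+ con (+ 8750268) :* var^ 12 :+ con (+ 4710744) :* var^ 10 :+ con (+ 1562886) :* var^ 8
         :+ con (+ 294168) :* var^ 6 :+ con (+ 17020) :* var^ 4 :- con (+ 3480) :* var^ 2 :- con (+ 207))
xExpr 4F = (con (+ 3) :* var^ 2 :- con (+ 1)) :* (con (+ 27) :* var^ 4 :- con (+ 2) :* var^ 2 :+ con (+ 3))
       :* (con (+ 19683) :* var^ 12 :+ con (+ 16362) :* var^ 10 :+ con (+ 34533) :* var^ 8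
           :+ con (+ 8748) :* var^ 6 :+ con (+ 3837) :* var^ 4 :+ con (+ 202) :* var^ 2 :+ con (+ 27))

squareRoot : Fin 5 → Expr
squareRoot 0F = con (+ 1594323) :* var^ 18 :+ con (+ 9296937) :* var^ 16 :+ con (+ 22594140) :* var^ 14
                :+ con (+ 19243332) :* var^ 12 :+ con (+ 8696106) :* var^ 10 :+ con (+ 2679822) :* var^ 8
                :+ con (+ 480012) :* var^ 6 :+ con (+ 49204) :* var^ 4 :+ con (+ 1947) :* var^ 2 :+ con (+ 81)
squareRoot 1F = con (+ 1594323) :* var^ 18 :+ con (+ 10346697) :* var^ 16 :+ con (+ 19087164) :* var^ 14
                :+ con (+ 18540900) :* var^ 12 :+ con (+ 8379018) :* var^ 10 :+ con (+ 2709486) :* var^ 8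
                :+ con (+ 497580) :* var^ 6 :+ con (+ 63380) :* var^ 4 :+ con (+ 5307) :* var^ 2 :+ con (+ 81)
squareRoot 2F = con (+ 1594323) :* var^ 18 :+ con (+ 11606409) :* var^ 16 :+ con (+ 15401340) :* var^ 14
                :+ con (+ 13434660) :* var^ 12 :+ con (+ 8128458) :* var^ 10 :+ con (+ 2793006) :* var^ 8
                :+ con (+ 686700) :* var^ 6 :+ con (+ 78548) :* var^ 4 :+ con (+ 4731) :* var^ 2 :+ con (+ 81)
squareRoot 3F = con (+ 1594323) :* var^ 18 :+ con (+ 4258089) :* var^ 16 :+ con (+ 11956572) :* var^ 14
                :+ con (+ 12960324) :* var^ 12 :+ con (+ 8039466) :* var^ 10 :+ con (+ 2898702) :* var^ 8
                :+ con (+ 712716) :* var^ 6 :+ con (+ 92980) :* var^ 4 :+ con (+ 4251) :* var^ 2 :+ con (+ 81)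
squareRoot 4F = con (+ 2) :* var :* (con (+ 2952450) :* var^ 16 :+ con (+ 7523280) :* var^ 14
                :+ con (+ 11155320) :* var^ 12 :+ con (+ 6819120) :* var^ 10 :+ con (+ 2961612) :* var^ 8
                :+ con (+ 757680) :* var^ 6 :+ con (+ 137720) :* var^ 4 :+ con (+ 10320) :* var^ 2 :+ con (+ 450))

square : Expr → Expr
square e = e :* e

sumOthersSqExpr : Fin 5 → Expr
sumOthersSqExpr 0F = square (xExpr 1F) :+ square (xExpr 2F) :+ square (xExpr 3F) :+ square (xExpr 4F)
sumOthersSqExpr 1F = square (xExpr 0F) :+ square (xExpr 2F) :+ square (xExpr 3F) :+ square (xExpr 4F)
sumOthersSqExpr 2F = square (xExpr 0F) :+ square (xExpr 1F) :+ square (xExpr 3F) :+ square (xExpr 4F)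
sumOthersSqExpr 3F = square (xExpr 0F) :+ square (xExpr 1F) :+ square (xExpr 2F) :+ square (xExpr 4F)
sumOthersSqExpr 4F = square (xExpr 0F) :+ square (xExpr 1F) :+ square (xExpr 2F) :+ square (xExpr 3F)

⟦sumOthersSqExpr⟧ : ∀ t j → sumOthersSq t j ≡ ⟦ sumOthersSqExpr j ⟧ t
⟦sumOthersSqExpr⟧ t 0F = ≡.refl
⟦sumOthersSqExpr⟧ t 1F = ≡.refl
⟦sumOthersSqExpr⟧ t 2F = ≡.refl
⟦sumOthersSqExpr⟧ t 3F = ≡.refl
⟦sumOthersSqExpr⟧ t 4F = ≡.refl

norm-sumOthersSqExpr : ∀ j → norm (sumOthersSqExpr j) ≡ norm (square (squareRoot j))
norm-sumOthersSqExpr 0F = ≡.refl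
norm-sumOthersSqExpr 1F = ≡.refl
norm-sumOthersSqExpr 2F = ≡.refl
norm-sumOthersSqExpr 3F = ≡.refl
norm-sumOthersSqExpr 4F = ≡.refl

mainTheorem6 : (t : ℤ) → (j : Fin 5) → ∃ λ (y : ℤ) → sumOthersSq t j ≡ y * y
mainTheorem6 t j = ⟦ squareRoot j ⟧ t , (begin
  sumOthersSq t j                          ≡⟨ ⟦sumOthersSqExpr⟧ t j ⟩
  ⟦ sumOthersSqExpr j ⟧ t                  ≡⟨ norm≡⇒⟦⟧≡ (sumOthersSqExpr j) (square (squareRoot j))
                                                         (norm-sumOthersSqExpr j) t ⟩
  ⟦ squareRoot j ⟧ t * ⟦ squareRoot j ⟧ t  ∎)
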